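{- Let $T\in(\mathbb{Z}/2)[x]$ have degree $n$. Suppose there are a positive integer $N$ and a constant $C_\cap$ such that for all $k\geq N$, \[a_T(2k)=2a_T(k)+a_T\!\left(k+\left\lfloor\tfrac n2\right\rfloor\right)+a_T\!\left(k+\left\lfloor\tfrac{n+1}2\right\rfloor\right)+C_\cap\] and \[a_T(2k+1)=a_T(k)+a_T(k+1)+a_T\!\left(k+\left\lfloor\tfrac{n+1}2\right\rfloor\right)+a_T\!\left(k+\left\lfloor\tfrac n2\right\rfloor+1\right)+C_\cap.\] For $|z|<\frac12$ define $f_T(z)=\sum_{k=2N}^\infty a_T(k)z^k$. Then there is a polynomial $P_T(z)$ such that for all complex $z$ with $0<|z|<\frac12$, \[f_T(z)=P_T(z)+\frac{C_\cap z^{2N}}{1-z}+\frac{1}{z^{n+1}}(1+z^n)(1+z)^2f_T(z^2).\]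
   Context: The automaton $A_2(1;T)$ has line $r\geq0$ equal to $T(x)^r\in(\mathbb{Z}/2)[x]$. Each line is identified with the bi-infinite sequence $(a_j)_{j\in\mathbb{Z}}$ of its coefficients, with zeros outside the support. A string $w\in(\mathbb{Z}/2)^k$ is $k$-accessible if $w=(a_j,\dots,a_{j+k-1})$ for some line and some $j\in\mathbb{Z}$. $a_T(k)$ is the number of $k$-accessible blocks for $k\geq1$, and $a_T(0)=1$; note $a_T(k)\leq 2^k$. -}

module Defs where

open import Data.Bool using (Bool; true; false; _xor_; if_then_else_)
open import Data.Nat as ℕ using (ℕ; zero; suc; _≤ᵇ_)
open import Data.Integer as ℤ using (ℤ; +_; -[1+_])
open import Data.List using (List; []; _∷_; length)
open import Data.Vec using (Vec; lookup)
open import Data.Fin using (Fin; toℕ)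
open import Data.Product using (Σ; ∃; _×_)
open import Data.List.Membership.Propositional using (_∈_)
open import Data.List.Relation.Unary.Unique.Propositional using (Unique)
open import Relation.Binary.PropositionalEquality using (_≡_)

-- Polynomials over Z/2, as coefficient lists (constant term first).

GF2Poly : Set
GF2Poly = List Bool

padd : GF2Poly → GF2Poly → GF2Poly
padd []      q       = q
padd (a ∷ p) []      = a ∷ p
padd (a ∷ p) (b ∷ q) = (a xor b) ∷ padd p q

pmul : GF2Poly → GF2Poly → GF2Poly
pmul []      q = []
pmul (a ∷ p) q = padd (if a then q else []) (false ∷ pmul p q)

ppow : GF2Poly → ℕ → GF2Poly
ppow T zero    = true ∷ []
ppow T (suc r) = pmul T (ppow T r)

coeffℕ : GF2Poly → ℕ → Bool
coeffℕ []      _       = false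
coeffℕ (a ∷ p) zero    = a
coeffℕ (a ∷ p) (suc j) = coeffℕ p j

-- the line viewed as a bi-infinite sequence (a_j)_{j ∈ ℤ}
coeff : GF2Poly → ℤ → Bool
coeff p (+ j)    = coeffℕ p j
coeff p -[1+ _ ] = false

-- line r of the automaton A_2(1;T) is T(x)^r
line : GF2Poly → ℕ → GF2Poly
line T r = ppow T r

Accessible : GF2Poly → (k : ℕ) → Vec Bool k → Set
Accessible T k w =
  Σ ℕ λ r → Σ ℤ λ j → (i : Fin k) → lookup w i ≡ coeff (line T r) (j ℤ.+ + toℕ i)

CountAccessible : GF2Poly → ℕ → ℕ → Set
CountAccessible T k m =
  Σ (List (Vec Bool k)) λ L →
    Unique L × length L ≡ m ×
    ((w : Vec Bool k) → (w ∈ L → Accessible T k w) × (Accessible T k w → w ∈ L))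

IsAccessCount : GF2Poly → (ℕ → ℕ) → Set
IsAccessCount T a = (a 0 ≡ 1) × ((k : ℕ) → ℕ.NonZero k → CountAccessible T k (a k))

-- Formal power series with integer coefficients: coefficient functions.

Series : Set
Series = ℕ → ℤ

_⊕_ : Series → Series → Series
(s ⊕ t) m = s m ℤ.+ t m

-- multiplication by z^d
shiftS : ℕ → Series → Series
shiftS d s m = if d ≤ᵇ m then s (m ℕ.∸ d) else + 0

onePlusZPow : ℕ → Series → Series
onePlusZPow d s = s ⊕ shiftS d s

sqArg : Series → Series
sqArg s m = if (m ℕ.% 2) ℕ.≡ᵇ 0 then s (m ℕ./ 2) else + 0

polyS : List ℤ → Series
polyS []      _       = + 0
polyS (c ∷ p) zero    = c
polyS (c ∷ p) (suc m) = polyS p m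

-- C z^M / (1 - z) = Σ_{m ≥ M} C z^m
geomFrom : ℤ → ℕ → Series
geomFrom C M m = if M ≤ᵇ m then C else + 0

fT : (ℕ → ℕ) → ℕ → Series
fT a N k = if (2 ℕ.* N) ≤ᵇ k then + (a k) else + 0

-- The two recurrences are a single one: for K ≥ 2N,
--   a(K) = a⌈(n+K)/2⌉ + a⌊(n+K)/2⌋ + a⌈K/2⌉ + a⌊K/2⌋ + C.
-- Since (1+z) g(z²) = Σₘ g⌊m/2⌋ zᵐ, the right-hand side is C plus the coefficient of z^(n+1+K)
-- in (1+zⁿ)(1+z)² f(z²).  Hence z^(n+1) f(z) and C z^(n+1+2N)/(1-z) + (1+zⁿ)(1+z)² f(z²) agree
-- from degree n+1+4N on, and their finitely many other differences form z^(n+1) P(z), provided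
-- (1+zⁿ)(1+z)² f(z²), which starts at degree 4N, has no terms of degree ≤ n.  That holds because
-- n < 2N: otherwise h = ⌊n/2⌋ ≥ N, and the two recurrences at k = h force a(h+1) = a(h), whereas
-- a is strictly increasing (each k-block extends to the left to a (k+1)-block, and the distinct
-- accessible blocks 10ᵏ and 0ᵏ⁺¹ of the line T⁰ = 1 have the same tail).

module Submission where

open import Defs
open import Data.Bool using (Bool; true; false; if_then_else_)
open import Data.Bool.Properties using (T-≡)
open import Data.Nat using (ℕ; zero; suc; _+_; _*_; _∸_; _≤_; _<_; _≥_; _≤ᵇ_; NonZero; ⌊_/2⌋; ⌈_/2⌉; z≤n; s≤s; >-nonZero; >-nonZero⁻¹)
open import Data.Nat.Properties
open import Data.Integer as ℤ using (ℤ; +_)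
import Data.Integer.Properties as ℤ
open import Data.List using (List; []; _∷_; _++_; length; map; applyUpTo)
open import Data.List.Properties using (length-map)
open import Data.List.Membership.Propositional using (_∈_)
open import Data.List.Membership.Propositional.Properties using (∈-map⁺)
open import Data.List.Relation.Binary.Subset.Propositional using (_⊆_)
open import Data.List.Relation.Unary.All as All using ()
open import Data.List.Relation.Unary.AllPairs using (_∷_)
open import Data.List.Relation.Unary.Any using (here; there)
open import Data.List.Relation.Unary.Unique.Propositional using (Unique)
open import Data.Vec using (Vec; lookup; replicate; tail) renaming (_∷_ to _∷ᵥ_)
open import Data.Vec.Properties using (lookup-replicate)
open import Data.Fin using (toℕ) renaming (zero to fzero; suc to fsuc)
open import Data.Product using (Σ; _×_; _,_; proj₁; proj₂)
open import Data.Sum using (_⊎_; inj₁; inj₂; [_,_])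
import Data.Sum as Sum
open import Function using (id; _∘_; Equivalence; it)
open import Relation.Nullary using (yes; no; contradiction)
open import Relation.Binary.PropositionalEquality using (_≡_; refl; sym; trans; cong; cong₂; subst; module ≡-Reasoning)
open import Data.Nat.DivMod using (m*n%n≡0; m*n/n≡m; [m+kn]%n≡m%n)
import Data.Integer.Tactic.RingSolver as ℤ-Solver
import Data.Nat.Tactic.RingSolver as ℕ-Solver

module _ {A : Set} where

  removeMember : ∀ {x : A} (ys : List A) → x ∈ ys →
                 Σ (List A) λ zs → length ys ≡ suc (length zs) × (∀ {y} → y ∈ ys → y ≡ x ⊎ y ∈ zs)
  removeMember (y ∷ ys) (here refl) = ys , refl , λ { (here y≡x) → inj₁ y≡x ; (there y∈ys) → inj₂ y∈ys }
  removeMember (y ∷ ys) (there x∈ys) with removeMember ys x∈ys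
  ... | zs , |ys| , split = y ∷ zs , cong suc |ys| , λ { (here refl) → inj₂ (here refl) ; (there y∈ys) → Sum.map₂ there (split y∈ys) }

  Unique-⊆⇒length-≤ : ∀ {xs ys : List A} → Unique xs → xs ⊆ ys → length xs ≤ length ys
  Unique-⊆⇒length-≤ {[]}     _            _   = z≤n
  Unique-⊆⇒length-≤ {x ∷ xs} {ys} (x∉xs ∷ xs!) x∷xs⊆ys with removeMember ys (x∷xs⊆ys (here refl))
  ... | zs , |ys| , split = subst (suc (length xs) ≤_) (sym |ys|) (s≤s (Unique-⊆⇒length-≤ xs! xs⊆zs))
    where
    xs⊆zs : xs ⊆ zs
    xs⊆zs y∈xs = [ (λ y≡x → contradiction (sym y≡x) (All.lookup x∉xs y∈xs)) , id ] (split (x∷xs⊆ys (there y∈xs)))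

Accessible-extendˡ : ∀ {T k} {w : Vec Bool k} → Accessible T k w → Σ Bool λ b → Accessible T (suc k) (b ∷ᵥ w)
Accessible-extendˡ {T} {w = w} (r , j , w≡) = b , r , j ℤ.- + 1 , b∷w≡
  where
  b : Bool
  b = coeff (line T r) (j ℤ.- + 1)
  j-1+[1+i]≡j+i : ∀ (j i : ℤ) → (j ℤ.- + 1) ℤ.+ (+ 1 ℤ.+ i) ≡ j ℤ.+ i
  j-1+[1+i]≡j+i = ℤ-Solver.solve-∀
  b∷w≡ : ∀ i → lookup (b ∷ᵥ w) i ≡ coeff (line T r) ((j ℤ.- + 1) ℤ.+ + toℕ i)
  b∷w≡ fzero    = cong (coeff (line T r)) (sym (ℤ.+-identityʳ (j ℤ.- + 1)))
  b∷w≡ (fsuc i) = trans (w≡ i) (cong (coeff (line T r)) (sym (j-1+[1+i]≡j+i j (+ toℕ i))))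

Accessible-10ᵏ : ∀ T k → Accessible T (suc k) (true ∷ᵥ replicate k false)
Accessible-10ᵏ T k = 0 , + 0 , λ { fzero → refl ; (fsuc i) → lookup-replicate i false }

Accessible-0ᵏ : ∀ T k → Accessible T k (replicate k false)
Accessible-0ᵏ T k = 0 , + 1 , λ i → lookup-replicate i false

CountAccessible-suc-< : ∀ {T k m m′} → CountAccessible T k m → CountAccessible T (suc k) m′ → m < m′
CountAccessible-suc-< {T} {k} (L , L! , refl , L≈) (L′ , _ , refl , L′≈)
  with removeMember L′ (proj₂ (L′≈ (true ∷ᵥ replicate k false)) (Accessible-10ᵏ T k))
... | zs , |L′| , split = begin-strict
  length L             ≤⟨ Unique-⊆⇒length-≤ L! L⊆tail[zs] ⟩
  length (map tail zs) ≡⟨ length-map tail zs ⟩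
  length zs            <⟨ n<1+n _ ⟩
  suc (length zs)      ≡⟨ sym |L′| ⟩
  length L′            ∎
  where
  open ≤-Reasoning
  0ᵏ⁺¹∈zs : replicate (suc k) false ∈ zs
  0ᵏ⁺¹∈zs = [ (λ ()) , id ] (split (proj₂ (L′≈ (replicate (suc k) false)) (Accessible-0ᵏ T (suc k))))
  L⊆tail[zs] : L ⊆ map tail zs
  L⊆tail[zs] {w} w∈L with Accessible-extendˡ (proj₁ (L≈ w) w∈L)
  ... | b , b∷w-acc with split (proj₂ (L′≈ (b ∷ᵥ w)) b∷w-acc)
  ...   | inj₁ refl  = ∈-map⁺ tail 0ᵏ⁺¹∈zs   -- b ∷ w ≡ 10ᵏ, so w ≡ 0ᵏ ≡ tail 0ᵏ⁺¹
  ...   | inj₂ b∷w∈zs = ∈-map⁺ tail b∷w∈zs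

IsAccessCount⇒strictlyIncreasing : ∀ {T a} → IsAccessCount T a → ∀ k → {{NonZero k}} → a k < a (suc k)
IsAccessCount⇒strictlyIncreasing (_ , count) k = CountAccessible-suc-< (count k it) (count (suc k) it)

data Parity : ℕ → Set where
  even : ∀ k → Parity (2 * k)
  odd  : ∀ k → Parity (suc (2 * k))

parity : ∀ m → Parity m
parity zero    = even 0
parity (suc m) with parity m
... | even k = odd k
... | odd k  = subst Parity (*-suc 2 k) (even (suc k))

⌊2k/2⌋≡k : ∀ k → ⌊ 2 * k /2⌋ ≡ k
⌊2k/2⌋≡k zero    = refl
⌊2k/2⌋≡k (suc k) = trans (cong ⌊_/2⌋ (*-suc 2 k)) (cong suc (⌊2k/2⌋≡k k))

⌊1+2k/2⌋≡k : ∀ k → ⌊ suc (2 * k) /2⌋ ≡ k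
⌊1+2k/2⌋≡k zero    = refl
⌊1+2k/2⌋≡k (suc k) = trans (cong (⌊_/2⌋ ∘ suc) (*-suc 2 k)) (cong suc (⌊1+2k/2⌋≡k k))

⌊m+2k/2⌋≡k+⌊m/2⌋ : ∀ m k → ⌊ m + 2 * k /2⌋ ≡ k + ⌊ m /2⌋
⌊m+2k/2⌋≡k+⌊m/2⌋ zero          k = trans (⌊2k/2⌋≡k k) (sym (+-identityʳ k))
⌊m+2k/2⌋≡k+⌊m/2⌋ (suc zero)    k = trans (⌊1+2k/2⌋≡k k) (sym (+-identityʳ k))
⌊m+2k/2⌋≡k+⌊m/2⌋ (suc (suc m)) k = trans (cong suc (⌊m+2k/2⌋≡k+⌊m/2⌋ m k)) (sym (+-suc k ⌊ m /2⌋))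

2m≤n⇒m≤⌊n/2⌋ : ∀ {m n} → 2 * m ≤ n → m ≤ ⌊ n /2⌋
2m≤n⇒m≤⌊n/2⌋ {m} 2m≤n = subst (_≤ _) (⌊2k/2⌋≡k m) (⌊n/2⌋-mono 2m≤n)

⌊n/2⌋<N⇒n<2N : ∀ n {N} → ⌊ n /2⌋ < N → n < 2 * N
⌊n/2⌋<N⇒n<2N n {N} n/2<N with parity n
... | even p = *-monoʳ-< 2 (subst (_< N) (⌊2k/2⌋≡k p) n/2<N)
... | odd p  = subst (_≤ 2 * N) (*-suc 2 p) (*-monoʳ-≤ 2 (subst (_< N) (⌊1+2k/2⌋≡k p) n/2<N))

if-≤ᵇ-then : ∀ {A : Set} {m n} {x y : A} → m ≤ n → (if m ≤ᵇ n then x else y) ≡ x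
if-≤ᵇ-then m≤n rewrite Equivalence.to T-≡ (≤⇒≤ᵇ m≤n) = refl

if-≤ᵇ-else : ∀ {A : Set} {m n} {x y : A} → n < m → (if m ≤ᵇ n then x else y) ≡ y
if-≤ᵇ-else {m = m} {n} n<m with m ≤ᵇ n in m≤ᵇn
... | true  = contradiction (≤ᵇ⇒≤ m n (Equivalence.from T-≡ m≤ᵇn)) (<⇒≱ n<m)
... | false = refl

shiftS-< : ∀ d (s : Series) {m} → m < d → shiftS d s m ≡ + 0
shiftS-< d s = if-≤ᵇ-else

shiftS-+ : ∀ d (s : Series) m → shiftS d s (d + m) ≡ s m
shiftS-+ d s m = trans (if-≤ᵇ-then (m≤m+n d m)) (cong s (m+n∸m≡n d m))

onePlusZPow-+ : ∀ d (s : Series) m → onePlusZPow d s (d + m) ≡ s (d + m) ℤ.+ s m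
onePlusZPow-+ d s m = cong (ℤ._+_ (s (d + m))) (shiftS-+ d s m)

sqArg-2* : ∀ (s : Series) q → sqArg s (2 * q) ≡ s q
sqArg-2* s q rewrite *-comm 2 q | m*n%n≡0 q 2 {{it}} | m*n/n≡m q 2 {{it}} = refl

sqArg-1+2* : ∀ (s : Series) q → sqArg s (suc (2 * q)) ≡ + 0
sqArg-1+2* s q rewrite *-comm 2 q | [m+kn]%n≡m%n 1 q 2 {{it}} = refl

onePlusZ-sqArg : ∀ (s : Series) m → onePlusZPow 1 (sqArg s) m ≡ s ⌊ m /2⌋
onePlusZ-sqArg s zero = ℤ.+-identityʳ (s 0)
onePlusZ-sqArg s (suc m) with parity m
... | even k = begin
  sqArg s (suc (2 * k)) ℤ.+ sqArg s (2 * k) ≡⟨ cong₂ ℤ._+_ (sqArg-1+2* s k) (sqArg-2* s k) ⟩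
  + 0 ℤ.+ s k                               ≡⟨ ℤ.+-identityˡ (s k) ⟩
  s k                                       ≡⟨ cong s (sym (⌊1+2k/2⌋≡k k)) ⟩
  s ⌊ suc (2 * k) /2⌋                       ∎
  where open ≡-Reasoning
... | odd k = begin
  sqArg s (2 + 2 * k) ℤ.+ sqArg s (suc (2 * k)) ≡⟨ cong₂ ℤ._+_ (cong (sqArg s) (sym (*-suc 2 k))) (sqArg-1+2* s k) ⟩
  sqArg s (2 * suc k) ℤ.+ + 0                   ≡⟨ ℤ.+-identityʳ _ ⟩
  sqArg s (2 * suc k)                           ≡⟨ sqArg-2* s (suc k) ⟩
  s (suc k)                                     ≡⟨ cong s (sym (⌊2k/2⌋≡k (suc k))) ⟩
  s ⌊ 2 * suc k /2⌋                             ≡⟨ cong (s ∘ ⌊_/2⌋) (*-suc 2 k) ⟩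
  s ⌊ 2 + 2 * k /2⌋                             ∎
  where open ≡-Reasoning

onePlusZ²-sqArg-suc : ∀ (s : Series) x → onePlusZPow 1 (onePlusZPow 1 (sqArg s)) (suc x) ≡ s ⌈ x /2⌉ ℤ.+ s ⌊ x /2⌋
onePlusZ²-sqArg-suc s x = cong₂ ℤ._+_ (onePlusZ-sqArg s (suc x)) (onePlusZ-sqArg s x)

VanishesBelow : Series → ℕ → Set
VanishesBelow s b = ∀ {m} → m < b → s m ≡ + 0

onePlusZPow-vanishesBelow : ∀ d {s b} → VanishesBelow s b → VanishesBelow (onePlusZPow d s) b
onePlusZPow-vanishesBelow d {s} s≈0 {m} m<b = cong₂ ℤ._+_ (s≈0 m<b) shifted≈0
  where
  shifted≈0 : (if d ≤ᵇ m then s (m ∸ d) else + 0) ≡ + 0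
  shifted≈0 with d ≤ᵇ m
  ... | true  = s≈0 (≤-<-trans (m∸n≤m m d) m<b)
  ... | false = refl

sqArg-vanishesBelow : ∀ {s b} → VanishesBelow s b → VanishesBelow (sqArg s) (2 * b)
sqArg-vanishesBelow {s} s≈0 {m} m<2b with parity m
... | even k = trans (sqArg-2* s k) (s≈0 (*-cancelˡ-< 2 k _ m<2b))
... | odd k  = sqArg-1+2* s k

fT-vanishesBelow : ∀ a N → VanishesBelow (fT a N) (2 * N)
fT-vanishesBelow a N = if-≤ᵇ-else

polyS-applyUpTo-< : ∀ (c : ℕ → ℤ) {B K} → K < B → polyS (applyUpTo c B) K ≡ c K
polyS-applyUpTo-< c {suc B} {zero}  _         = refl
polyS-applyUpTo-< c {suc B} {suc K} (s≤s K<B) = polyS-applyUpTo-< (c ∘ suc) K<B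

polyS-applyUpTo-≥ : ∀ (c : ℕ → ℤ) {B K} → B ≤ K → polyS (applyUpTo c B) K ≡ + 0
polyS-applyUpTo-≥ c {zero}          _         = refl
polyS-applyUpTo-≥ c {suc B} {suc K} (s≤s B≤K) = polyS-applyUpTo-≥ (c ∘ suc) B≤K

eventuallyEqual⇒polynomialDifference : ∀ B (s t : Series) → (∀ {K} → B ≤ K → s K ≡ t K) →
                                        Σ (List ℤ) λ P → ∀ K → s K ≡ polyS P K ℤ.+ t K
eventuallyEqual⇒polynomialDifference B s t s≈t = applyUpTo d B , s≡P+t
  where
  d : ℕ → ℤ
  d K = s K ℤ.- t K
  x-y+y≡x : ∀ (x y : ℤ) → (x ℤ.- y) ℤ.+ y ≡ x
  x-y+y≡x = ℤ-Solver.solve-∀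
  s≡P+t : ∀ K → s K ≡ polyS (applyUpTo d B) K ℤ.+ t K
  s≡P+t K with K <? B
  ... | yes K<B = sym (trans (cong (ℤ._+ t K) (polyS-applyUpTo-< d K<B)) (x-y+y≡x (s K) (t K)))
  ... | no  K≮B = trans (s≈t (≮⇒≥ K≮B)) (sym (trans (cong (ℤ._+ t K) (polyS-applyUpTo-≥ d (≮⇒≥ K≮B))) (ℤ.+-identityˡ (t K))))

shiftS-identity : ∀ d (s p g q : Series) → VanishesBelow q d → (∀ K → s K ≡ p K ℤ.+ (g K ℤ.+ q (d + K))) →
                  ∀ m → shiftS d s m ≡ (shiftS d p ⊕ (shiftS d g ⊕ q)) m
shiftS-identity d s p g q q≈0 s≡ m with m <? d
... | yes m<d = trans (shiftS-< d s m<d) (sym (cong₂ ℤ._+_ (shiftS-< d p m<d) (cong₂ ℤ._+_ (shiftS-< d g m<d) (q≈0 m<d))))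
... | no  m≮d = subst (λ m → shiftS d s m ≡ (shiftS d p ⊕ (shiftS d g ⊕ q)) m) (m+[n∸m]≡n (≮⇒≥ m≮d)) (at-d+ (m ∸ d))
  where
  at-d+ : ∀ K → shiftS d s (d + K) ≡ (shiftS d p ⊕ (shiftS d g ⊕ q)) (d + K)
  at-d+ K = trans (shiftS-+ d s K)
                  (trans (s≡ K) (sym (cong₂ ℤ._+_ (shiftS-+ d p K) (cong (ℤ._+ q (d + K)) (shiftS-+ d g K)))))

sameOffset : ∀ {x y p q : ℕ} {C : ℤ} → + x ≡ + p ℤ.+ C → + y ≡ + q ℤ.+ C → x + q ≡ y + p
sameOffset {x} {y} {p} {q} {C} x≡p+C y≡q+C = ℤ.+-injective (begin
  + (x + q)              ≡⟨ ℤ.pos-+ x q ⟩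
  + x ℤ.+ + q            ≡⟨ cong (ℤ._+ + q) x≡p+C ⟩
  (+ p ℤ.+ C) ℤ.+ + q    ≡⟨ swap (+ p) (+ q) C ⟩
  (+ q ℤ.+ C) ℤ.+ + p    ≡⟨ cong (ℤ._+ + p) y≡q+C ⟨
  + y ℤ.+ + p            ≡⟨ ℤ.pos-+ y p ⟨
  + (y + p)              ∎)
  where
  open ≡-Reasoning
  swap : ∀ (i j c : ℤ) → (i ℤ.+ c) ℤ.+ j ≡ (j ℤ.+ c) ℤ.+ i
  swap = ℤ-Solver.solve-∀

EvenRecurrence OddRecurrence : ℕ → (ℕ → ℕ) → ℕ → ℤ → Set
EvenRecurrence n a N C =
  ∀ k → k ≥ N → + a (2 * k) ≡ + (2 * a k + a (k + ⌊ n /2⌋) + a (k + ⌈ n /2⌉)) ℤ.+ C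
OddRecurrence n a N C =
  ∀ k → k ≥ N → + a (suc (2 * k)) ≡ + (a k + a (suc k) + a (k + ⌈ n /2⌉) + a (suc (k + ⌊ n /2⌋))) ℤ.+ C

module _ {n : ℕ} {a : ℕ → ℕ} {N : ℕ} {C : ℤ} (rec₂ : EvenRecurrence n a N C) (rec₂₊₁ : OddRecurrence n a N C) where

  halvingRecurrence : ∀ K → N ≤ ⌊ K /2⌋ →
                      + a K ≡ + ((a ⌈ n + K /2⌉ + a ⌊ n + K /2⌋) + (a ⌈ K /2⌉ + a ⌊ K /2⌋)) ℤ.+ C
  halvingRecurrence K N≤K/2 with parity K
  ... | even k = trans (rec₂ k (subst (N ≤_) (⌊2k/2⌋≡k k) N≤K/2)) (cong (λ t → + t ℤ.+ C) (begin
    2 * a k + a (k + ⌊ n /2⌋) + a (k + ⌈ n /2⌉)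
      ≡⟨ reorder (a k) (a (k + ⌊ n /2⌋)) (a (k + ⌈ n /2⌉)) ⟩
    (a (k + ⌈ n /2⌉) + a (k + ⌊ n /2⌋)) + (a k + a k)
      ≡⟨ cong₂ _+_ (cong₂ _+_ (cong a ⌈n+K/2⌉) (cong a ⌊n+K/2⌋)) (cong₂ _+_ (cong a ⌈K/2⌉) (cong a ⌊K/2⌋)) ⟨
    (a ⌈ n + 2 * k /2⌉ + a ⌊ n + 2 * k /2⌋) + (a ⌈ 2 * k /2⌉ + a ⌊ 2 * k /2⌋) ∎))
    where
    open ≡-Reasoning
    ⌈n+K/2⌉ : ⌈ n + 2 * k /2⌉ ≡ k + ⌈ n /2⌉
    ⌈n+K/2⌉ = ⌊m+2k/2⌋≡k+⌊m/2⌋ (suc n) k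
    ⌊n+K/2⌋ : ⌊ n + 2 * k /2⌋ ≡ k + ⌊ n /2⌋
    ⌊n+K/2⌋ = ⌊m+2k/2⌋≡k+⌊m/2⌋ n k
    ⌈K/2⌉ : ⌈ 2 * k /2⌉ ≡ k
    ⌈K/2⌉ = ⌊1+2k/2⌋≡k k
    ⌊K/2⌋ : ⌊ 2 * k /2⌋ ≡ k
    ⌊K/2⌋ = ⌊2k/2⌋≡k k
    reorder : ∀ x y z → 2 * x + y + z ≡ (z + y) + (x + x)
    reorder = ℕ-Solver.solve-∀
  ... | odd k = trans (rec₂₊₁ k (subst (N ≤_) (⌊1+2k/2⌋≡k k) N≤K/2)) (cong (λ t → + t ℤ.+ C) (begin
    a k + a (suc k) + a (k + ⌈ n /2⌉) + a (suc (k + ⌊ n /2⌋))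
      ≡⟨ reorder (a k) (a (suc k)) (a (k + ⌈ n /2⌉)) (a (suc (k + ⌊ n /2⌋))) ⟩
    (a (suc (k + ⌊ n /2⌋)) + a (k + ⌈ n /2⌉)) + (a (suc k) + a k)
      ≡⟨ cong₂ _+_ (cong₂ _+_ (cong a ⌈n+K/2⌉) (cong a ⌊n+K/2⌋)) (cong₂ _+_ (cong a ⌈K/2⌉) (cong a ⌊K/2⌋)) ⟨
    (a ⌈ n + suc (2 * k) /2⌉ + a ⌊ n + suc (2 * k) /2⌋) + (a ⌈ suc (2 * k) /2⌉ + a ⌊ suc (2 * k) /2⌋) ∎))
    where
    open ≡-Reasoning
    ⌈n+K/2⌉ : ⌈ n + suc (2 * k) /2⌉ ≡ suc (k + ⌊ n /2⌋)
    ⌈n+K/2⌉ = trans (cong ⌈_/2⌉ (+-suc n (2 * k))) (cong suc (⌊m+2k/2⌋≡k+⌊m/2⌋ n k))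
    ⌊n+K/2⌋ : ⌊ n + suc (2 * k) /2⌋ ≡ k + ⌈ n /2⌉
    ⌊n+K/2⌋ = trans (cong ⌊_/2⌋ (+-suc n (2 * k))) (⌊m+2k/2⌋≡k+⌊m/2⌋ (suc n) k)
    ⌈K/2⌉ : ⌈ suc (2 * k) /2⌉ ≡ suc k
    ⌈K/2⌉ = cong suc (⌊2k/2⌋≡k k)
    ⌊K/2⌋ : ⌊ suc (2 * k) /2⌋ ≡ k
    ⌊K/2⌋ = ⌊1+2k/2⌋≡k k
    reorder : ∀ w x y z → w + x + y + z ≡ (z + y) + (x + w)
    reorder = ℕ-Solver.solve-∀

  stationaryAt⌊n/2⌋ : N ≤ ⌊ n /2⌋ → a (suc ⌊ n /2⌋) ≡ a ⌊ n /2⌋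
  stationaryAt⌊n/2⌋ N≤h = +-cancelˡ-≡ (x + y + A + c) _ _ (begin
    (x + y + A + c) + A′           ≡⟨ reorder₁ x y A A′ c ⟩
    x + (A + A′ + c + y)           ≡⟨ sameOffset {C = C} even-h odd-h ⟩
    y + (2 * A + x + c)            ≡⟨ reorder₂ x y A c ⟩
    (x + y + A + c) + A            ∎)
    where
    open ≡-Reasoning
    h A A′ x y c : ℕ
    h = ⌊ n /2⌋
    A = a h
    A′ = a (suc h)
    x = a (h + h)
    y = a (suc (h + h))
    c = a (h + ⌈ n /2⌉)
    2h≡h+h : 2 * h ≡ h + h
    2h≡h+h = cong (_+_ h) (+-identityʳ h)
    even-h : + x ≡ + (2 * A + x + c) ℤ.+ C
    even-h = subst (λ t → + a t ≡ + (2 * A + x + c) ℤ.+ C) 2h≡h+h (rec₂ h N≤h)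
    odd-h : + y ≡ + (A + A′ + c + y) ℤ.+ C
    odd-h = subst (λ t → + a (suc t) ≡ + (A + A′ + c + y) ℤ.+ C) 2h≡h+h (rec₂₊₁ h N≤h)
    reorder₁ : ∀ x y A A′ c → (x + y + A + c) + A′ ≡ x + (A + A′ + c + y)
    reorder₁ = ℕ-Solver.solve-∀
    reorder₂ : ∀ x y A c → y + (2 * A + x + c) ≡ (x + y + A + c) + A
    reorder₂ = ℕ-Solver.solve-∀

  increasing⇒⌊n/2⌋<N : .{{NonZero N}} → (∀ k → {{NonZero k}} → a k < a (suc k)) → ⌊ n /2⌋ < N
  increasing⇒⌊n/2⌋<N increasing with N ≤? ⌊ n /2⌋
  ... | no  N≰⌊n/2⌋ = ≰⇒> N≰⌊n/2⌋
  ... | yes N≤⌊n/2⌋ = contradiction (sym (stationaryAt⌊n/2⌋ N≤⌊n/2⌋)) (<⇒≢ (increasing ⌊ n /2⌋ {{⌊n/2⌋≢0}}))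
    where
    ⌊n/2⌋≢0 : NonZero ⌊ n /2⌋
    ⌊n/2⌋≢0 = >-nonZero (<-≤-trans (>-nonZero⁻¹ N) N≤⌊n/2⌋)

  seriesIdentity : n < 2 * N →
    Σ (List ℤ) λ P → ∀ m →
      shiftS (suc n) (fT a N) m ≡
        (shiftS (suc n) (polyS P) ⊕ (shiftS (suc n) (geomFrom C (2 * N)) ⊕
          onePlusZPow n (onePlusZPow 1 (onePlusZPow 1 (sqArg (fT a N)))))) m
  seriesIdentity n<2N = P , shiftS-identity (suc n) f (polyS P) G Q Q≈0 f≡P+G+Q
    where
    open ≡-Reasoning
    f G W Q : Series
    f = fT a N
    G = geomFrom C (2 * N)
    W = onePlusZPow 1 (onePlusZPow 1 (sqArg f))
    Q = onePlusZPow n W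

    f≡a : ∀ {k} → 2 * N ≤ k → f k ≡ + a k
    f≡a = if-≤ᵇ-then

    Q≈0 : VanishesBelow Q (suc n)
    Q≈0 m<1+n = onePlusZPow-vanishesBelow n (onePlusZPow-vanishesBelow 1 (onePlusZPow-vanishesBelow 1
                  (sqArg-vanishesBelow (fT-vanishesBelow a N)))) (<-≤-trans m<1+n (≤-trans n<2N (m≤n*m (2 * N) 2)))

    W-suc : ∀ x → 2 * (2 * N) ≤ x → W (suc x) ≡ + (a ⌈ x /2⌉ + a ⌊ x /2⌋)
    W-suc x 4N≤x = begin
      W (suc x)                   ≡⟨ onePlusZ²-sqArg-suc f x ⟩
      f ⌈ x /2⌉ ℤ.+ f ⌊ x /2⌋     ≡⟨ cong₂ ℤ._+_ (f≡a (≤-trans 2N≤x/2 (⌊n/2⌋≤⌈n/2⌉ x))) (f≡a 2N≤x/2) ⟩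
      + a ⌈ x /2⌉ ℤ.+ + a ⌊ x /2⌋ ≡⟨ ℤ.pos-+ (a ⌈ x /2⌉) (a ⌊ x /2⌋) ⟨
      + (a ⌈ x /2⌉ + a ⌊ x /2⌋)   ∎
      where
      2N≤x/2 : 2 * N ≤ ⌊ x /2⌋
      2N≤x/2 = 2m≤n⇒m≤⌊n/2⌋ 4N≤x

    Q-shift : ∀ K → Q (suc n + K) ≡ W (suc (n + K)) ℤ.+ W (suc K)
    Q-shift K = begin
      Q (suc (n + K))               ≡⟨ cong Q (+-suc n K) ⟨
      Q (n + suc K)                 ≡⟨ onePlusZPow-+ n W (suc K) ⟩
      W (n + suc K) ℤ.+ W (suc K)   ≡⟨ cong (λ t → W t ℤ.+ W (suc K)) (+-suc n K) ⟩
      W (suc (n + K)) ℤ.+ W (suc K) ∎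

    largeCoefficients : ∀ {K} → 2 * (2 * N) ≤ K → f K ≡ G K ℤ.+ Q (suc n + K)
    largeCoefficients {K} 4N≤K = begin
      f K                                     ≡⟨ f≡a 2N≤K ⟩
      + a K                                   ≡⟨ halvingRecurrence K (≤-trans (m≤n*m N 2) (2m≤n⇒m≤⌊n/2⌋ 4N≤K)) ⟩
      + (S₁ + S₂) ℤ.+ C                       ≡⟨ ℤ.+-comm (+ (S₁ + S₂)) C ⟩
      C ℤ.+ + (S₁ + S₂)                       ≡⟨ cong₂ ℤ._+_ (if-≤ᵇ-then 2N≤K) (ℤ.pos-+ S₁ S₂) ⟨
      G K ℤ.+ (+ S₁ ℤ.+ + S₂)                 ≡⟨ cong (ℤ._+_ (G K)) (cong₂ ℤ._+_ (W-suc (n + K) (≤-trans 4N≤K (m≤n+m K n))) (W-suc K 4N≤K)) ⟨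
      G K ℤ.+ (W (suc (n + K)) ℤ.+ W (suc K)) ≡⟨ cong (ℤ._+_ (G K)) (Q-shift K) ⟨
      G K ℤ.+ Q (suc n + K)                   ∎
      where
      S₁ S₂ : ℕ
      S₁ = a ⌈ n + K /2⌉ + a ⌊ n + K /2⌋
      S₂ = a ⌈ K /2⌉ + a ⌊ K /2⌋
      2N≤K : 2 * N ≤ K
      2N≤K = ≤-trans (m≤n*m (2 * N) 2) 4N≤K

    correction : Σ (List ℤ) λ P → ∀ K → f K ≡ polyS P K ℤ.+ (G K ℤ.+ Q (suc n + K))
    correction = eventuallyEqual⇒polynomialDifference (2 * (2 * N)) f (λ K → G K ℤ.+ Q (suc n + K)) largeCoefficients

    P : List ℤ
    P = proj₁ correction
    f≡P+G+Q : ∀ K → f K ≡ polyS P K ℤ.+ (G K ℤ.+ Q (suc n + K))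
    f≡P+G+Q = proj₂ correction

mainTheorem14 :
    (cs : List Bool) →
    let T = cs ++ (true ∷ [])
        n = length cs
    in (a : ℕ → ℕ) → IsAccessCount T a →
       (N : ℕ) → NonZero N → (C : ℤ) →
       ((k : ℕ) → k ≥ N →
          + (a (2 * k)) ≡ ℤ._+_ (+ (2 * a k + a (k + ⌊ n /2⌋) + a (k + ⌊ suc n /2⌋))) C) →
       ((k : ℕ) → k ≥ N →
          + (a (suc (2 * k))) ≡ ℤ._+_ (+ (a k + a (suc k) + a (k + ⌊ suc n /2⌋) + a (suc (k + ⌊ n /2⌋)))) C) →
       Σ (List ℤ) λ P → (m : ℕ) →
         shiftS (suc n) (fT a N) m ≡
           (shiftS (suc n) (polyS P) ⊕ (shiftS (suc n) (geomFrom C (2 * N)) ⊕ onePlusZPow n (onePlusZPow 1 (onePlusZPow 1 (sqArg (fT a N)))))) m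
mainTheorem14 cs a count N N≢0 C rec₂ rec₂₊₁ = seriesIdentity {a = a} {C = C} rec₂ rec₂₊₁ (⌊n/2⌋<N⇒n<2N n ⌊n/2⌋<N)
  where
  n : ℕ
  n = length cs
  ⌊n/2⌋<N : ⌊ n /2⌋ < N
  ⌊n/2⌋<N = increasing⇒⌊n/2⌋<N {a = a} {C = C} rec₂ rec₂₊₁ {{N≢0}} (IsAccessCount⇒strictlyIncreasing count)
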